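{- Let $B\in\mathrm{Bic}(T)$ and let $(B_1,B)$, $(B_2,B)$ be distinct covering relations in $\mathrm{Bic}(T)$. Then the segments $s_1=\lambda(B_1,B)$ and $s_2=\lambda(B_2,B)$ satisfy $s_1\neq s_2$, and $s_1$ is not a split of $s_2$.
   Context: Let $T$ be a finite tree embedded in a disk so that exactly its leaves lie on the boundary, with every non-leaf vertex of degree at least $3$; the embedding gives a cyclic order of edges at each vertex. A segment is an acyclic path $(v_1,\dots,v_n)$, $n\ge2$, of pairwise distinct consecutive-adjacent vertices such that for each $1\le j\le n-2$ the edge $\{v_{j+1},v_{j+2}\}$ is immediately clockwise or counterclockwise from $\{v_j,v_{j+1}\}$ at $v_{j+1}$; $\mathrm{Seg}(T)$ is the set of segments. For segments $s_1=(v_1,\dots,v_k)$, $s_2=(v_k,\dots,v_n)$ sharing only $v_k$, $s_1\circ s_2=(v_1,\dots,v_n)$; they are composable if this is a segment. $B\subseteq\mathrm{Seg}(T)$ is closed if it contains $s_1\circ s_2$ for all composable $s_1,s_2\in B$, biclosed if $B$ and its complement are closed. $\mathrm{Bic}(T)$ is the lattice of biclosed sets under inclusion; its covering relations are exactly the pairs $(B',B'\sqcup\{s\})$ of biclosed sets, and $\lambda(B',B'\sqcup\{s\}):=s$. A split of a segment $t$ is a proper subsegment of $t$ sharing an endpoint with $t$. -}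

module Defs where

open import Data.Nat using (ℕ; _≤_; _<_)
open import Data.Fin using (Fin)
open import Data.Bool using (Bool; true; false)
open import Data.Maybe using (just)
open import Data.List using (List; []; _∷_; _++_; [_]; length; reverse; head; last)
open import Data.List.Membership.Propositional using (_∈_; _∉_)
open import Data.List.Relation.Unary.Unique.Propositional using (Unique)
open import Data.Product using (Σ; ∃; _×_)
open import Data.Sum using (_⊎_)
open import Data.Unit using (⊤)
open import Data.Empty using (⊥)
open import Relation.Nullary using (¬_)
open import Relation.Binary.PropositionalEquality using (_≡_)

Consec : ∀ {A : Set} → List A → A → A → Set
Consec []           a b = ⊥
Consec (x ∷ [])     a b = ⊥
Consec (x ∷ y ∷ r)  a b = (a ≡ x × b ≡ y) ⊎ Consec (y ∷ r) a b

CycSucc : ∀ {A : Set} → List A → A → A → Set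
CycSucc []       a b = ⊥
CycSucc (x ∷ xs) a b = Consec (x ∷ xs ++ [ x ]) a b

-- Plane trees (trees embedded in a disk, leaves on the boundary),
-- encoded by a rotation system: rot v lists the neighbours of v in
-- clockwise cyclic order.

module _ {n : ℕ} (rot : Fin n → List (Fin n)) where

  Adj : Fin n → Fin n → Set
  Adj u v = v ∈ rot u

  Chain : List (Fin n) → Set
  Chain []           = ⊤
  Chain (x ∷ [])     = ⊤
  Chain (x ∷ y ∷ r)  = Adj x y × Chain (y ∷ r)

  Connected : Set
  Connected = ∀ u v → ∃ λ (xs : List (Fin n)) →
                Chain xs × head xs ≡ just u × last xs ≡ just v

  HasCycle : Set
  HasCycle = Σ (Fin n) λ x → Σ (List (Fin n)) λ r →
               3 ≤ length (x ∷ r) × Unique (x ∷ r) × Chain (x ∷ r ++ [ x ])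

record PlaneTree (n : ℕ) : Set where
  field
    rot        : Fin n → List (Fin n)
    rot-unique : ∀ v → Unique (rot v)
    loopless   : ∀ v → v ∉ rot v
    symmetric  : ∀ u v → u ∈ rot v → v ∈ rot u
    connected  : Connected rot
    acyclic    : ¬ HasCycle rot
    degree     : ∀ v → length (rot v) ≡ 1 ⊎ 3 ≤ length (rot v)

module _ {n : ℕ} (T : PlaneTree n) where
  open PlaneTree T

  -- the edge {b,c} is immediately clockwise or counterclockwise
  -- from the edge {a,b} at b
  Turn : Fin n → Fin n → Fin n → Set
  Turn a b c = CycSucc (rot b) a c ⊎ CycSucc (rot b) c a

  Turns : List (Fin n) → Set
  Turns (a ∷ b ∷ c ∷ r) = Turn a b c × Turns (b ∷ c ∷ r)
  Turns _               = ⊤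

  IsSegment : List (Fin n) → Set
  IsSegment s = 2 ≤ length s × Unique s × Chain rot s × Turns s

  -- segments are paths, identified with their reversal
  SameSeg : List (Fin n) → List (Fin n) → Set
  SameSeg s t = s ≡ t ⊎ s ≡ reverse t

  -- Sets of segments: Boolean predicates on vertex lists, supported on
  -- segments and invariant under reversal.
  SegSet : Set
  SegSet = List (Fin n) → Bool

  _∈S_ : List (Fin n) → SegSet → Set
  s ∈S B = B s ≡ true

  WellFormed : SegSet → Set
  WellFormed B = (∀ s → s ∈S B → IsSegment s) × (∀ s → B s ≡ B (reverse s))

  _⊆S_ : SegSet → SegSet → Set
  B ⊆S C = ∀ s → s ∈S B → s ∈S C

  _≐S_ : SegSet → SegSet → Set
  B ≐S C = ∀ s → B s ≡ C s

  -- closedness of a family P of segments under composition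
  -- (p ++ [v]) ∘ (v ∷ q) = p ++ v ∷ q
  ClosedP : (List (Fin n) → Set) → Set
  ClosedP P = ∀ p v q → P (p ++ [ v ]) → P (v ∷ q) →
              IsSegment (p ++ v ∷ q) → P (p ++ v ∷ q)

  Closed : SegSet → Set
  Closed B = ClosedP (λ s → s ∈S B)

  CoClosed : SegSet → Set
  CoClosed B = ClosedP (λ s → IsSegment s × B s ≡ false)

  Biclosed : SegSet → Set
  Biclosed B = WellFormed B × Closed B × CoClosed B

  Cover : SegSet → SegSet → Set
  Cover B' B = Biclosed B' × Biclosed B × B' ⊆S B × ¬ (B ⊆S B') ×
               (∀ C → Biclosed C → B' ⊆S C → C ⊆S B →
                  ¬ (C ⊆S B') → ¬ (B ⊆S C) → ⊥)

  -- s = λ(B', B) : B = B' ⊔ {s}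
  Label : SegSet → SegSet → List (Fin n) → Set
  Label B' B s = IsSegment s × B' s ≡ false ×
                 (∀ t → t ∈S B → t ∈S B' ⊎ SameSeg t s) ×
                 (∀ t → t ∈S B' ⊎ SameSeg t s → t ∈S B)

  IsSplit : List (Fin n) → List (Fin n) → Set
  IsSplit s t = 2 ≤ length s × length s < length t ×
                Σ (List (Fin n)) λ s' → SameSeg s' s ×
                  ((∃ λ r → t ≡ s' ++ r) ⊎ (∃ λ r → t ≡ r ++ s'))

module Submission where

-- Equal labels: a label determines its lower cover, since B₁ and B₂ both
-- equal B minus that segment; hence B₁ = B₂.
--
-- Splits: if s₁ is a split of s₂, then s₂ is the composite of two strictly
-- shorter segments, one of them s₁ and the other some u (a "cut" of s₂).
-- Being shorter than s₂, neither piece is s₂, so each piece lying in B lies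
-- in B₂, and each piece outside B lies outside B₁.  If u ∈ B, both pieces
-- lie in B₂ and closedness of B₂ puts s₂ into B₂, contradicting
-- s₂ = λ(B₂,B).  If u ∉ B, both pieces lie outside B₁ (as s₁ ∉ B₁) and
-- co-closedness of B₁ keeps s₂ out of B₁, although s₂ ∈ B minus {s₁} = B₁.

open import Defs
open import Data.Nat using (ℕ; _≤_; _<_; s≤s; z≤n)
open import Data.Nat.Properties using (<-irrefl; ≤-trans; ≤-reflexive)
open import Data.Fin using (Fin)
open import Data.Bool using (true; false)
open import Data.Bool.Properties using (⇔→≡)
open import Data.List using (List; []; _∷_; _++_; [_]; length; initLast; _∷ʳ′_)
open import Data.List.Properties
  using (length-reverse; reverse-involutive; ++-identityʳ; ∷ʳ-++; length-++-≤ʳ)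
open import Data.List.Relation.Unary.AllPairs using ([]; _∷_)
import Data.List.Relation.Unary.All.Properties as All
open import Data.List.Relation.Unary.Unique.Propositional using (Unique)
open import Data.Product using (Σ; _×_; _,_; proj₁; proj₂)
open import Data.Sum using (_⊎_; inj₁; inj₂)
open import Data.Unit using (tt)
open import Data.Empty using (⊥; ⊥-elim)
open import Function.Bundles using (mk⇔)
open import Relation.Nullary using (¬_)
open import Relation.Binary.PropositionalEquality using (_≡_; refl; sym; trans; cong; subst)

-- A cut of s at an interior vertex v: s = (a ∷ p) ++ v ∷ (b ∷ q).  Its two
-- pieces (a ∷ p) ++ [ v ] and v ∷ b ∷ q share only v, and s is their
-- composite in the sense of ClosedP.
record Cut {A : Set} (s : List A) : Set where
  constructor cut
  field
    a : A
    p : List A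
    v : A
    b : A
    q : List A
    split : s ≡ (a ∷ p) ++ v ∷ b ∷ q

  left : List A
  left = (a ∷ p) ++ [ v ]

  right : List A
  right = v ∷ b ∷ q

open Cut

module _ {A : Set} where

  left-shorter : ∀ {s : List A} (c : Cut s) → length (left c) < length s
  left-shorter (cut a p v b q refl) = s≤s (go p)
    where
    go : ∀ xs → length (xs ++ [ v ]) < length (xs ++ v ∷ b ∷ q)
    go []       = s≤s (s≤s z≤n)
    go (x ∷ xs) = s≤s (go xs)

  right-shorter : ∀ {s : List A} (c : Cut s) → length (right c) < length s
  right-shorter (cut a p v b q refl) = s≤s (length-++-≤ʳ (v ∷ b ∷ q) {p})

  prefix-cut : ∀ (s r : List A) → 2 ≤ length s → length s < length (s ++ r) →
               Σ (Cut (s ++ r)) λ c → left c ≡ s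
  prefix-cut s [] _ shorter =
    ⊥-elim (<-irrefl (sym (cong length (++-identityʳ s))) shorter)
  prefix-cut s (b ∷ q) two _ with initLast s
  ... | []               with () ← two
  ... | [] ∷ʳ′ v         with s≤s () ← two
  ... | (a ∷ p) ∷ʳ′ v    = cut a p v b q (cong (a ∷_) (∷ʳ-++ p v (b ∷ q))) , refl

  suffix-cut : ∀ (r s : List A) → 2 ≤ length s → length s < length (r ++ s) →
               Σ (Cut (r ++ s)) λ c → right c ≡ s
  suffix-cut []      s           _           shorter = ⊥-elim (<-irrefl refl shorter)
  suffix-cut (a ∷ p) []          ()          _
  suffix-cut (a ∷ p) (v ∷ [])    (s≤s ())    _
  suffix-cut (a ∷ p) (v ∷ b ∷ q) _           _       = cut a p v b q refl , refl

module _ {n : ℕ} (T : PlaneTree n) where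
  open PlaneTree T

  unique-prefix : ∀ (xs : List (Fin n)) {ys} → Unique (xs ++ ys) → Unique xs
  unique-prefix []       _       = []
  unique-prefix (x ∷ xs) (p ∷ u) = All.++⁻ˡ xs p ∷ unique-prefix xs u

  unique-suffix : ∀ (xs : List (Fin n)) {ys} → Unique (xs ++ ys) → Unique ys
  unique-suffix []       u       = u
  unique-suffix (x ∷ xs) (_ ∷ u) = unique-suffix xs u

  chain-prefix : ∀ (xs : List (Fin n)) {ys} → Chain rot (xs ++ ys) → Chain rot xs
  chain-prefix []          _       = tt
  chain-prefix (x ∷ [])    _       = tt
  chain-prefix (x ∷ y ∷ r) (e , c) = e , chain-prefix (y ∷ r) c

  chain-tail : ∀ x (xs : List (Fin n)) → Chain rot (x ∷ xs) → Chain rot xs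
  chain-tail x []       _       = tt
  chain-tail x (y ∷ xs) (_ , c) = c

  chain-suffix : ∀ (xs : List (Fin n)) {ys} → Chain rot (xs ++ ys) → Chain rot ys
  chain-suffix []       c = c
  chain-suffix (x ∷ xs) c = chain-suffix xs (chain-tail x _ c)

  turns-prefix : ∀ (xs : List (Fin n)) {ys} → Turns T (xs ++ ys) → Turns T xs
  turns-prefix []              _       = tt
  turns-prefix (x ∷ [])        _       = tt
  turns-prefix (x ∷ y ∷ [])    _       = tt
  turns-prefix (x ∷ y ∷ z ∷ r) (t , c) = t , turns-prefix (y ∷ z ∷ r) c

  turns-tail : ∀ x (xs : List (Fin n)) → Turns T (x ∷ xs) → Turns T xs
  turns-tail x []           _       = tt
  turns-tail x (y ∷ [])     _       = tt
  turns-tail x (y ∷ z ∷ xs) (_ , c) = c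

  turns-suffix : ∀ (xs : List (Fin n)) {ys} → Turns T (xs ++ ys) → Turns T ys
  turns-suffix []       c = c
  turns-suffix (x ∷ xs) c = turns-suffix xs (turns-tail x _ c)

  segment-prefix : ∀ xs ys → IsSegment T (xs ++ ys) → 2 ≤ length xs → IsSegment T xs
  segment-prefix xs ys (_ , u , c , t) two =
    two , unique-prefix xs u , chain-prefix xs c , turns-prefix xs t

  segment-suffix : ∀ xs ys → IsSegment T (xs ++ ys) → 2 ≤ length ys → IsSegment T ys
  segment-suffix xs ys (_ , u , c , t) two =
    two , unique-suffix xs u , chain-suffix xs c , turns-suffix xs t

  left-segment : ∀ {s} (c : Cut s) → IsSegment T s → IsSegment T (left c)
  left-segment (cut a p v b q refl) seg =
    segment-prefix (a ∷ p ++ [ v ]) (b ∷ q)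
      (subst (IsSegment T) (sym (cong (a ∷_) (∷ʳ-++ p v (b ∷ q)))) seg)
      (s≤s (snoc-nonempty p))
    where
    snoc-nonempty : ∀ xs → 1 ≤ length (xs ++ [ v ])
    snoc-nonempty []      = s≤s z≤n
    snoc-nonempty (_ ∷ _) = s≤s z≤n

  right-segment : ∀ {s} (c : Cut s) → IsSegment T s → IsSegment T (right c)
  right-segment (cut a p v b q refl) seg =
    segment-suffix (a ∷ p) (v ∷ b ∷ q) seg (s≤s (s≤s z≤n))

  same-length : ∀ {s t} → SameSeg T s t → length s ≡ length t
  same-length         (inj₁ refl) = refl
  same-length {t = t} (inj₂ refl) = length-reverse t

  same-sym : ∀ {s t} → SameSeg T s t → SameSeg T t s
  same-sym (inj₁ refl) = inj₁ refl
  same-sym (inj₂ refl) = inj₂ (sym (reverse-involutive _))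

  same-trans : ∀ {s t u} → SameSeg T s t → SameSeg T t u → SameSeg T s u
  same-trans (inj₁ refl) q           = q
  same-trans (inj₂ refl) (inj₁ refl) = inj₂ refl
  same-trans (inj₂ refl) (inj₂ refl) = inj₁ (reverse-involutive _)

  shorter-not-same : ∀ {s t} → length s < length t → ¬ SameSeg T s t
  shorter-not-same shorter same = <-irrefl (same-length same) shorter

  wf-same : ∀ {B} → WellFormed T B → ∀ {s t} → SameSeg T s t → B s ≡ B t
  wf-same wf         (inj₁ refl) = refl
  wf-same wf {t = t} (inj₂ refl) = sym (proj₂ wf t)

  true≢false : true ≡ false → ⊥
  true≢false ()

  label-upper : ∀ {B' B s t} → Label T B' B s → SameSeg T t s → B t ≡ true
  label-upper (_ , _ , _ , up) same = up _ (inj₂ same)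

  label-⊆ : ∀ {B' B s} → Label T B' B s → _⊆S_ T B' B
  label-⊆ (_ , _ , _ , up) t t∈B' = up t (inj₁ t∈B')

  label-keep : ∀ {B' B s t} → Label T B' B s → B t ≡ true → ¬ SameSeg T t s → B' t ≡ true
  label-keep (_ , _ , down , _) t∈B t≉s with down _ t∈B
  ... | inj₁ t∈B' = t∈B'
  ... | inj₂ t≈s  = ⊥-elim (t≉s t≈s)

  label-out : ∀ {B' B s t} → Label T B' B s → B t ≡ false → B' t ≡ false
  label-out {B'} {t = t} L t∉B with B' t in e
  ... | true  = trans (sym (label-⊆ L t e)) t∉B
  ... | false = refl

  label-not-lower : ∀ {B' B s t} → WellFormed T B' → Label T B' B s →
                    SameSeg T t s → B' t ≡ false
  label-not-lower wf (_ , s∉B' , _) same = trans (wf-same wf same) s∉B'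

  same-label-lower-⊆ : ∀ {B B₁ B₂ s₁ s₂} → WellFormed T B₁ →
                       Label T B₁ B s₁ → Label T B₂ B s₂ → SameSeg T s₁ s₂ →
                       _⊆S_ T B₁ B₂
  same-label-lower-⊆ wf₁ L₁ L₂ s₁≈s₂ t t∈B₁ =
    label-keep L₂ (label-⊆ L₁ t t∈B₁) λ t≈s₂ →
      true≢false (trans (sym t∈B₁) (label-not-lower wf₁ L₁ (same-trans t≈s₂ (same-sym s₁≈s₂))))

  same-label-same-lower : ∀ {B B₁ B₂ s₁ s₂} → WellFormed T B₁ → WellFormed T B₂ →
                          Label T B₁ B s₁ → Label T B₂ B s₂ → SameSeg T s₁ s₂ →
                          _≐S_ T B₁ B₂
  same-label-same-lower wf₁ wf₂ L₁ L₂ s₁≈s₂ t =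
    ⇔→≡ (mk⇔ (same-label-lower-⊆ wf₁ L₁ L₂ s₁≈s₂ t)
              (same-label-lower-⊆ wf₂ L₂ L₁ (same-sym s₁≈s₂) t))

  label-not-piece : ∀ {B B₁ B₂ s₁ s₂} → WellFormed T B₁ → CoClosed T B₁ → Closed T B₂ →
                    Label T B₁ B s₁ → Label T B₂ B s₂ → (c : Cut s₂) →
                    SameSeg T (left c) s₁ ⊎ SameSeg T (right c) s₁ → ⊥
  label-not-piece {B} {B₁} {B₂} {s₁} wf₁ coclosed₁ closed₂ L₁ L₂
                  c@(cut a p v b q refl) piece = case piece
    where
    s₂ = (a ∷ p) ++ v ∷ b ∷ q
    X  = left c
    Y  = right c

    s₁-shorter : SameSeg T X s₁ ⊎ SameSeg T Y s₁ → length s₁ < length s₂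
    s₁-shorter (inj₁ X≈s₁) = subst (_< length s₂) (same-length X≈s₁) (left-shorter c)
    s₁-shorter (inj₂ Y≈s₁) = subst (_< length s₂) (same-length Y≈s₁) (right-shorter c)

    s₂∈B₁ : B₁ s₂ ≡ true
    s₂∈B₁ = label-keep L₁ (label-upper L₂ (inj₁ refl))
              (λ s₂≈s₁ → shorter-not-same (s₁-shorter piece) (same-sym s₂≈s₁))

    piece-in : ∀ {w} → length w < length s₂ → B w ≡ true → B₂ w ≡ true
    piece-in shorter w∈B = label-keep L₂ w∈B (shorter-not-same shorter)

    both-in : B X ≡ true → B Y ≡ true → ⊥
    both-in X∈B Y∈B = true≢false (trans (sym s₂∈B₂) (proj₁ (proj₂ L₂)))
      where
      s₂∈B₂ : B₂ s₂ ≡ true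
      s₂∈B₂ = closed₂ (a ∷ p) v (b ∷ q)
                (piece-in (left-shorter c) X∈B) (piece-in (right-shorter c) Y∈B)
                (proj₁ L₂)

    both-out : B₁ X ≡ false → B₁ Y ≡ false → ⊥
    both-out X∉B₁ Y∉B₁ = true≢false (trans (sym s₂∈B₁) s₂∉B₁)
      where
      s₂∉B₁ : B₁ s₂ ≡ false
      s₂∉B₁ = proj₂ (coclosed₁ (a ∷ p) v (b ∷ q)
                (left-segment c (proj₁ L₂) , X∉B₁)
                (right-segment c (proj₁ L₂) , Y∉B₁)
                (proj₁ L₂))

    case : SameSeg T X s₁ ⊎ SameSeg T Y s₁ → ⊥
    case (inj₁ X≈s₁) with B Y in eY
    ... | true  = both-in (label-upper L₁ X≈s₁) eY
    ... | false = both-out (label-not-lower wf₁ L₁ X≈s₁) (label-out L₁ eY)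
    case (inj₂ Y≈s₁) with B X in eX
    ... | true  = both-in eX (label-upper L₁ Y≈s₁)
    ... | false = both-out (label-out L₁ eX) (label-not-lower wf₁ L₁ Y≈s₁)

  split-cut : ∀ {s₁ s₂} → IsSplit T s₁ s₂ →
              Σ (Cut s₂) λ c → SameSeg T (left c) s₁ ⊎ SameSeg T (right c) s₁
  split-cut {s₁} (two , shorter , s , s≈s₁ , prefix-or-suffix) =
    go (subst (_< _) (sym (same-length s≈s₁)) shorter) prefix-or-suffix
    where
    two′ : 2 ≤ length s
    two′ = ≤-trans two (≤-reflexive (sym (same-length s≈s₁)))

    piece≈s₁ : ∀ {w} → w ≡ s → SameSeg T w s₁
    piece≈s₁ refl = s≈s₁

    go : ∀ {s₂} → length s < length s₂ →
         (Σ (List (Fin n)) λ r → s₂ ≡ s ++ r) ⊎ (Σ (List (Fin n)) λ r → s₂ ≡ r ++ s) →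
         Σ (Cut s₂) λ c → SameSeg T (left c) s₁ ⊎ SameSeg T (right c) s₁
    go shorter′ (inj₁ (r , refl)) with prefix-cut s r two′ shorter′
    ... | c , left≡s = c , inj₁ (piece≈s₁ left≡s)
    go shorter′ (inj₂ (r , refl)) with suffix-cut r s two′ shorter′
    ... | c , right≡s = c , inj₂ (piece≈s₁ right≡s)

lemma4p4 : ∀ {n : ℕ} (T : PlaneTree n) (B B₁ B₂ : SegSet T)
    (s₁ s₂ : List (Fin n)) →
    Cover T B₁ B → Cover T B₂ B → ¬ (_≐S_ T B₁ B₂) →
    Label T B₁ B s₁ → Label T B₂ B s₂ →
    ¬ SameSeg T s₁ s₂ × ¬ IsSplit T s₁ s₂
lemma4p4 T B B₁ B₂ s₁ s₂ B₁⋖B B₂⋖B B₁≠B₂ L₁ L₂ = labels-differ , not-split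
  where
  -- only biclosedness of the two lower covers is needed
  bic₁ : Biclosed T B₁
  bic₁ = proj₁ B₁⋖B

  bic₂ : Biclosed T B₂
  bic₂ = proj₁ B₂⋖B

  labels-differ : ¬ SameSeg T s₁ s₂
  labels-differ s₁≈s₂ =
    B₁≠B₂ (same-label-same-lower T (proj₁ bic₁) (proj₁ bic₂) L₁ L₂ s₁≈s₂)

  not-split : ¬ IsSplit T s₁ s₂
  not-split split with split-cut T split
  ... | c , piece = label-not-piece T (proj₁ bic₁) (proj₂ (proj₂ bic₁))
                      (proj₁ (proj₂ bic₂)) L₁ L₂ c piece
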